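{- Let $X=[n]$ be the disjoint union of sets $X_1,\dots,X_r$, with $|X_k|=n_k$ for $k\in[r]$. Let $A_1,\dots,A_m,B_1,\dots,B_m\subseteq X$ be such that $\mathcal{P}=\{(A_i,B_i)\mid i\in[m]\}$ is a Bollobás system. Then for every $l\in[r]$, $$\sum_{i=1}^m \left(\prod_{k=1}^r \binom{|A_i\cap X_k|+|B_i\cap X_k|}{|A_i\cap X_k|}\right)^{ -1} \le \frac{\prod_{k=1}^r (1+n_k)}{1+n_l}.$$
   Context: A family of pairs of sets $\mathcal{P}=\{(A_i,B_i)\mid i\in[m]\}$ is called a Bollobás system if for all $i,j\in[m]$: $A_i\cap B_j=\emptyset$ if and only if $i=j$. Here $[n]=\{1,\dots,n\}$. -}

module Defs where

open import Data.Nat using (ℕ; zero; suc; _+_; _*_)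
open import Data.Nat.Combinatorics using (_C_)
open import Data.Fin using (Fin; zero; suc)
open import Data.Fin.Subset using (Subset; _∩_; ∣_∣; Empty)
open import Data.Vec using (tabulate)
open import Data.Integer using (+_)
open import Data.Rational using (ℚ; _/_; 0ℚ) renaming (_+_ to _+ℚ_)
open import Relation.Binary.PropositionalEquality using (_≡_)
open import Relation.Nullary.Decidable using (⌊_⌋)
open import Function.Bundles using (_⇔_)
import Data.Fin as F

sumℚ : ∀ {m} → (Fin m → ℚ) → ℚ
sumℚ {zero}  f = 0ℚ
sumℚ {suc m} f = f zero +ℚ sumℚ (λ i → f (suc i))

prodℕ : ∀ {r} → (Fin r → ℕ) → ℕ
prodℕ {zero}  f = 1
prodℕ {suc r} f = f zero * prodℕ (λ k → f (suc k))

-- reciprocal 1/d of a natural number as a rational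
-- (only ever applied to positive d below; the value at 0 is an irrelevant convention)
recip : ℕ → ℚ
recip zero    = 0ℚ
recip (suc d) = (+ 1) / suc d

-- The block X_k of the partition X = [n] = X_1 ⊔ … ⊔ X_r given by a
-- labelling part : Fin n → Fin r (x ∈ X_k iff part x = k)
block : ∀ {n r} → (Fin n → Fin r) → Fin r → Subset n
block part k = tabulate (λ x → ⌊ part x F.≟ k ⌋)

IsBollobas : ∀ {n m} → (Fin m → Subset n) → (Fin m → Subset n) → Set
IsBollobas A B = ∀ i j → Empty (A i ∩ B j) ⇔ (i ≡ j)

-- Enlarge every part X_k by one point: a threshold if k ≢ l, an unconstrained point if k ≡ l.
-- Order every enlarged part, and call pair i good for such an ordering if in every part all of
-- A_i comes before all of B_i, with the threshold in between when k ≢ l. At most one pair is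
-- good for any ordering: for i ≢ j take x ∈ A_i ∩ B_j and y ∈ A_j ∩ B_i; if x ∉ X_l it lies both
-- before and after the threshold of its part, likewise for y, and if both lie in X_l then
-- x < y < x. So the numbers of good orderings of all pairs sum to at most ∏_k (n_k + 1)!.
-- With a = |A_i ∩ X_k| and b = |B_i ∩ X_k|, part k has (n_k + 1)! / C(a + b, a) good orderings
-- if k ≡ l and (n_k + 1)! / ((a + b + 1) C(a + b, a)) ≥ n_k! / C(a + b, a) of them otherwise;
-- dividing by (n_l + 1) ∏_k n_k! gives the claim. Instead of enumerating orderings, both counts
-- are computed by the recursion that removes the last point of one part, and the bound on their
-- sum is proved by induction on the number of points.

module Submission where

open import Defs
open import Data.Nat.Base using (ℕ)
open import Data.Fin.Base using (Fin)
open import Data.Fin.Subset using (Subset)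

module SumsAndProducts where

  open import Data.Bool.Base using (Bool; true; false; if_then_else_; T)
  open import Data.Fin.Base using (Fin; zero; suc; punchIn)
  open import Data.Fin.Properties using (_≟_; suc-injective; punchInᵢ≢i)
  open import Data.Nat.Base using (ℕ; zero; suc; _+_; _*_; _≤_; z≤n)
  open import Data.Nat.Properties
    using (+-identityʳ; *-identityˡ; ≤-refl; ≤-reflexive; +-mono-≤; *-mono-≤;
           *-commutativeSemigroup; +-*-semiring)
  open import Data.Vec.Functional using (Vector; removeAt; updateAt)
  open import Data.Vec.Functional.Properties using (updateAt-updates; updateAt-minimal)
  open import Function.Base using (_∘_; const)
  open import Relation.Binary.PropositionalEquality
  open import Relation.Nullary.Decidable using (⌊_⌋; yes; no)
  open import Relation.Nullary.Negation using (contradiction)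
  open import Algebra.Properties.CommutativeSemigroup *-commutativeSemigroup using (x∙yz≈y∙xz; interchange)
  open import Algebra.Properties.Semiring.Sum +-*-semiring
    renaming (sum to ∑) using (sum-syntax; sum-remove; sum-cong-≗; sum-replicate-zero)

  prodℕ-cong : ∀ {n} {f g : Vector ℕ n} → (∀ k → f k ≡ g k) → prodℕ f ≡ prodℕ g
  prodℕ-cong {zero}  f≗g = refl
  prodℕ-cong {suc n} f≗g = cong₂ _*_ (f≗g zero) (prodℕ-cong (f≗g ∘ suc))

  prodℕ-ones : ∀ n → prodℕ {n} (λ _ → 1) ≡ 1
  prodℕ-ones zero    = refl
  prodℕ-ones (suc n) = trans (+-identityʳ (prodℕ {n} (λ _ → 1))) (prodℕ-ones n)

  prodℕ-mono-≤ : ∀ {n} {f g : Vector ℕ n} → (∀ k → f k ≤ g k) → prodℕ f ≤ prodℕ g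
  prodℕ-mono-≤ {zero}  f≤g = ≤-refl
  prodℕ-mono-≤ {suc n} f≤g = *-mono-≤ (f≤g zero) (prodℕ-mono-≤ (f≤g ∘ suc))

  prodℕ-distrib-* : ∀ {n} (f g : Vector ℕ n) → prodℕ (λ k → f k * g k) ≡ prodℕ f * prodℕ g
  prodℕ-distrib-* {zero}  f g = refl
  prodℕ-distrib-* {suc n} f g =
    trans (cong (f zero * g zero *_) (prodℕ-distrib-* (f ∘ suc) (g ∘ suc)))
          (interchange (f zero) (g zero) (prodℕ (f ∘ suc)) (prodℕ (g ∘ suc)))

  prodℕ-except : ∀ {n} → Vector ℕ n → Fin n → ℕ
  prodℕ-except f k = prodℕ (updateAt f k (const 1))

  prodℕ-split : ∀ {n} (f : Vector ℕ n) k → prodℕ f ≡ f k * prodℕ-except f k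
  prodℕ-split f zero    = cong (f zero *_) (sym (+-identityʳ (prodℕ (f ∘ suc))))
  prodℕ-split f (suc k) = begin
    f zero * prodℕ (f ∘ suc)                   ≡⟨ cong (f zero *_) (prodℕ-split (f ∘ suc) k) ⟩
    f zero * (f (suc k) * rest)                ≡⟨ x∙yz≈y∙xz (f zero) (f (suc k)) rest ⟩
    f (suc k) * (f zero * rest)                ∎
    where
    open ≡-Reasoning
    rest = prodℕ-except (f ∘ suc) k

  prodℕ-except-cong : ∀ {n} {f g : Vector ℕ n} k → (∀ j → j ≢ k → f j ≡ g j) →
                      prodℕ-except f k ≡ prodℕ-except g k
  prodℕ-except-cong {f = f} {g} k agree = prodℕ-cong same
    where
    same : ∀ j → updateAt f k (const 1) j ≡ updateAt g k (const 1) j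
    same j with j ≟ k
    ... | yes refl = trans (updateAt-updates j f) (sym (updateAt-updates j g))
    ... | no j≢k   = trans (updateAt-minimal j k f j≢k)
                           (trans (agree j j≢k) (sym (updateAt-minimal j k g j≢k)))

  prodℕ-split-agreeing : ∀ {n} {f g : Vector ℕ n} k → (∀ j → j ≢ k → f j ≡ g j) →
                         prodℕ f ≡ f k * prodℕ-except g k
  prodℕ-split-agreeing {f = f} k agree = trans (prodℕ-split f k) (cong (f k *_) (prodℕ-except-cong k agree))

  ∑-mono-≤ : ∀ {n} {f g : Vector ℕ n} → (∀ x → f x ≤ g x) → ∑ f ≤ ∑ g
  ∑-mono-≤ {zero}  f≤g = z≤n
  ∑-mono-≤ {suc n} f≤g = +-mono-≤ (f≤g zero) (∑-mono-≤ (f≤g ∘ suc))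

  ∑-if : ∀ {n} b (f : Vector ℕ n) → ∑[ x < n ] (if b then f x else 0) ≡ (if b then ∑ f else 0)
  ∑-if     true  f = refl
  ∑-if {n} false f = sum-replicate-zero n

  ∑-δ : ∀ {n} (k : Fin n) (f : Vector ℕ n) → ∑[ j < n ] (if ⌊ j ≟ k ⌋ then f j else 0) ≡ f k
  ∑-δ {suc n} k f = begin
    ∑ g
      ≡⟨ sum-remove {i = k} g ⟩
    g k + ∑ (removeAt g k)
      ≡⟨ cong₂ _+_ (cong (λ t → if t then f k else 0) (cong ⌊_⌋ (≡-≟-identity _≟_ refl)))
                   (trans (sum-cong-≗ others) (sum-replicate-zero n)) ⟩
    f k + 0
      ≡⟨ +-identityʳ (f k) ⟩
    f k ∎
    where
    open ≡-Reasoning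
    g : Vector ℕ (suc n)
    g j = if ⌊ j ≟ k ⌋ then f j else 0
    others : ∀ j → g (punchIn k j) ≡ 0
    others j = cong (λ t → if t then f (punchIn k j) else 0)
                    (cong ⌊_⌋ (≢-≟-identity _≟_ (punchInᵢ≢i k j)))

  indicator-* : ∀ b x → (if b then 1 else 0) * x ≡ (if b then x else 0)
  indicator-* true  x = *-identityˡ x
  indicator-* false x = refl

  if-mono-≤ : ∀ b {x y} → x ≤ y → (if b then x else 0) ≤ (if b then y else 0)
  if-mono-≤ true  x≤y = x≤y
  if-mono-≤ false x≤y = z≤n

  indicator-sum-≤1 : ∀ {n} (b : Fin n → Bool) → (∀ {i j} → T (b i) → T (b j) → i ≡ j) →
                     ∑[ i < n ] (if b i then 1 else 0) ≤ 1
  indicator-sum-≤1 {zero}  b unique = z≤n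
  indicator-sum-≤1 {suc n} b unique with b zero in b₀
  ... | false = indicator-sum-≤1 (b ∘ suc) (λ bᵢ bⱼ → suc-injective (unique bᵢ bⱼ))
  ... | true  = ≤-reflexive (cong suc (trans (sum-cong-≗ others) (sum-replicate-zero n)))
    where
    others : ∀ i → (if b (suc i) then 1 else 0) ≡ 0
    others i with b (suc i) in bᵢ
    ... | false = refl
    ... | true  = contradiction (unique (subst T (sym b₀) _) (subst T (sym bᵢ) _)) λ ()

module OrderCounting where

  open import Data.Bool.Base using (Bool; true; false; if_then_else_; _∧_; T)
  open import Data.Bool.Properties using (T-∧)
  open import Data.Nat.Base
  open import Data.Nat.Combinatorics using (_C_; nCk≡n!/k![n-k]!; k![n∸k]!∣n!)
  open import Data.Nat.DivMod using (_/_; m/n*n≡m)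
  open import Data.Nat.Properties
    using (+-suc; +-assoc; +-identityʳ; *-identityʳ; *-distribʳ-+; m+n∸m≡n; m≤m+n; *-monoˡ-≤; ≡ᵇ⇒≡;
           _!*_!≢0; *-commutativeSemigroup; module ≤-Reasoning)
  open import Data.Nat.Tactic.RingSolver using (solve-∀)
  open import Data.Product.Base using (proj₁; proj₂)
  open import Function.Bundles using (Equivalence)
  open import Relation.Binary.PropositionalEquality
  open import Algebra.Properties.CommutativeSemigroup *-commutativeSemigroup using (x∙yz≈y∙xz)

  data Role : Set where
    inA cut inB free : Role

  data _≺_ : Role → Role → Set where
    inA≺cut : inA ≺ cut
    inA≺inB : inA ≺ inB
    cut≺inB : cut ≺ inB

  _==_ : Role → Role → Bool
  inA  == inA  = true
  cut  == cut  = true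
  inB  == inB  = true
  free == free = true
  _    == _    = false

  ==-refl : ∀ s → s == s ≡ true
  ==-refl inA  = refl
  ==-refl cut  = refl
  ==-refl inB  = refl
  ==-refl free = refl

  Tally : Set
  Tally = Role → ℕ

  ⟨_,_,_,_⟩ : ℕ → ℕ → ℕ → ℕ → Tally
  ⟨ a , k , b , e ⟩ inA  = a
  ⟨ a , k , b , e ⟩ cut  = k
  ⟨ a , k , b , e ⟩ inB  = b
  ⟨ a , k , b , e ⟩ free = e

  sumRoles : Tally → ℕ
  sumRoles c = c inA + (c cut + (c inB + c free))

  sumRoles-cong : ∀ {f g : Tally} → (∀ s → f s ≡ g s) → sumRoles f ≡ sumRoles g
  sumRoles-cong f≗g = cong₂ _+_ (f≗g inA) (cong₂ _+_ (f≗g cut) (cong₂ _+_ (f≗g inB) (f≗g free)))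

  sumRoles-select : ∀ ρ (h : Tally) → sumRoles (λ s → if ρ == s then h s else 0) ≡ h ρ
  sumRoles-select inA  h = +-identityʳ (h inA)
  sumRoles-select cut  h = +-identityʳ (h cut)
  sumRoles-select inB  h = +-identityʳ (h inB)
  sumRoles-select free h = refl

  _─_ : Tally → Role → Tally
  (c ─ s) t = if s == t then pred (c t) else c t

  rising : ℕ → ℕ → ℕ
  rising t zero    = 1
  rising t (suc e) = (suc t + e) * rising t e

  -- The number of orderings of a part with tally c in which every inA point precedes every
  -- cut point and every cut point precedes every inB point: order these constrained points in
  -- c inA ! * c cut ! * c inB ! ways, then insert the free points one after the other.
  arrangements : Tally → ℕ
  arrangements c = c inA ! * c cut ! * c inB ! * rising (c inA + c cut + c inB) (c free)

  arrangements-cong : ∀ {c d} → (∀ s → c s ≡ d s) → arrangements c ≡ arrangements d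
  arrangements-cong c≗d rewrite c≗d inA | c≗d cut | c≗d inB | c≗d free = refl

  lastable : Role → Tally → Bool
  lastable inA  c = (c inB ≡ᵇ 0) ∧ (c cut ≡ᵇ 0)
  lastable cut  c = c inB ≡ᵇ 0
  lastable inB  c = true
  lastable free c = true

  lastable-≺ : ∀ {s t} c → T (lastable s c) → s ≺ t → c t ≡ 0
  lastable-≺ c last inA≺cut = ≡ᵇ⇒≡ (c cut) 0 (proj₂ (Equivalence.to T-∧ last))
  lastable-≺ c last inA≺inB = ≡ᵇ⇒≡ (c inB) 0 (proj₁ (Equivalence.to T-∧ last))
  lastable-≺ c last cut≺inB = ≡ᵇ⇒≡ (c inB) 0 last

  rising-shift : ∀ t e → suc t * rising (suc t) e ≡ rising t (suc e)
  rising-shift t zero    = cong (_* 1) (sym (+-identityʳ (suc t)))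
  rising-shift t (suc e) = begin
    suc t * ((suc (suc t) + e) * rising (suc t) e)
      ≡⟨ x∙yz≈y∙xz (suc t) (suc (suc t) + e) (rising (suc t) e) ⟩
    (suc (suc t) + e) * (suc t * rising (suc t) e)
      ≡⟨ cong₂ _*_ (sym (+-suc (suc t) e)) (rising-shift t e) ⟩
    (suc t + suc e) * rising t (suc e) ∎
    where open ≡-Reasoning

  rising-pascal : ∀ t e → rising (suc t) e ≡ rising t e + e * rising (suc t) (pred e)
  rising-pascal t zero    = refl
  rising-pascal t (suc e) = begin
    (suc (suc t) + e) * rising (suc t) e
      ≡⟨ cong (_* rising (suc t) e) (sym (+-suc (suc t) e)) ⟩
    (suc t + suc e) * rising (suc t) e
      ≡⟨ *-distribʳ-+ (rising (suc t) e) (suc t) (suc e) ⟩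
    suc t * rising (suc t) e + suc e * rising (suc t) e
      ≡⟨ cong (_+ suc e * rising (suc t) e) (rising-shift t e) ⟩
    rising t (suc e) + suc e * rising (suc t) e ∎
    where open ≡-Reasoning

  arrangements-last : ∀ c → 0 < sumRoles c →
    arrangements c ≡ sumRoles (λ s → c s * (if lastable s c then arrangements (c ─ s) else 0))
  arrangements-last c = by-top-role (c inA) (c cut) (c inB) (c free)
    where
    ByLast : Tally → Set
    ByLast d = arrangements d ≡ sumRoles (λ s → d s * (if lastable s d then arrangements (d ─ s) else 0))
    -- A last point is free or has the latest nonempty role among inA, cut and inB.
    by-top-role : ∀ a k b e → 0 < sumRoles ⟨ a , k , b , e ⟩ → ByLast ⟨ a , k , b , e ⟩
    by-top-role a k (suc b) e _
      rewrite +-suc (a + k) b | rising-pascal (a + k + b) e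
      = lem a (a !) k (k !) b (b !) e (rising (a + k + b) e) (rising (suc (a + k + b)) (pred e))
      where
      lem : ∀ a x k y b z e R₀ R₁ →
            x * y * (z + b * z) * (R₀ + e * R₁) ≡
            a * 0 + (k * 0 + (suc b * (x * y * z * R₀) + e * (x * y * (z + b * z) * R₁)))
      lem = solve-∀
    by-top-role a (suc k) zero e _
      rewrite +-identityʳ (a + suc k) | +-identityʳ (a + k) | +-suc a k | rising-pascal (a + k) e
      = lem a (a !) k (k !) e (rising (a + k) e) (rising (suc (a + k)) (pred e))
      where
      lem : ∀ a x k y e R₀ R₁ →
            x * (y + k * y) * 1 * (R₀ + e * R₁) ≡
            a * 0 + (suc k * (x * y * 1 * R₀) + (0 + e * (x * (y + k * y) * 1 * R₁)))
      lem = solve-∀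
    by-top-role (suc a) zero zero e _
      rewrite rising-pascal (a + 0 + 0) e
      = lem a (a !) e (rising (a + 0 + 0) e) (rising (suc (a + 0 + 0)) (pred e))
      where
      lem : ∀ a x e R₀ R₁ →
            (x + a * x) * 1 * 1 * (R₀ + e * R₁) ≡
            suc a * (x * 1 * 1 * R₀) + (0 + (0 + e * ((x + a * x) * 1 * 1 * R₁)))
      lem = solve-∀
    by-top-role zero zero zero (suc e) _ = lem e (rising 0 e)
      where
      lem : ∀ e R → 1 * (suc e * R) ≡ suc e * (1 * R)
      lem = solve-∀

  binomial*factorials : ∀ a b → ((a + b) C a) * (a ! * b !) ≡ (a + b) !
  binomial*factorials a b = begin
    ((a + b) C a) * (a ! * b !)  ≡⟨ cong (λ k → ((a + b) C a) * (a ! * k !)) (m+n∸m≡n a b) ⟨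
    ((a + b) C a) * d            ≡⟨ cong (_* d) (nCk≡n!/k![n-k]! (m≤m+n a b)) ⟩
    (a + b) ! / d * d            ≡⟨ m/n*n≡m (k![n∸k]!∣n! (m≤m+n a b)) ⟩
    (a + b) !                    ∎
    where
    open ≡-Reasoning
    d = a ! * (a + b ∸ a) !
    instance _ = a !* (a + b ∸ a) !≢0

  !*rising : ∀ t e → t ! * rising t e ≡ (t + e) !
  !*rising t zero    = trans (*-identityʳ (t !)) (cong _! (sym (+-identityʳ t)))
  !*rising t (suc e) = begin
    t ! * ((suc t + e) * rising t e)  ≡⟨ x∙yz≈y∙xz (t !) (suc t + e) (rising t e) ⟩
    suc (t + e) * (t ! * rising t e)  ≡⟨ cong (suc (t + e) *_) (!*rising t e) ⟩
    suc (t + e) !                     ≡⟨ cong _! (+-suc t e) ⟨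
    (t + suc e) !                     ∎
    where open ≡-Reasoning

  arrangements-cutless : ∀ c → c cut ≡ 0 → (sumRoles c) ! ≡ ((c inA + c inB) C c inA) * arrangements c
  arrangements-cutless c c-cut≡0 =
    subst (λ k → Count ⟨ c inA , k , c inB , c free ⟩) (sym c-cut≡0) (explicit (c inA) (c inB) (c free))
    where
    Count : Tally → Set
    Count d = (sumRoles d) ! ≡ ((d inA + d inB) C d inA) * arrangements d
    explicit : ∀ a b e → Count ⟨ a , 0 , b , e ⟩
    explicit a b e rewrite +-identityʳ a = begin
      (a + (b + e)) !                                     ≡⟨ cong _! (+-assoc a b e) ⟨
      (a + b + e) !                                       ≡⟨ !*rising (a + b) e ⟨
      (a + b) ! * R                                       ≡⟨ cong (_* R) (binomial*factorials a b) ⟨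
      ((a + b) C a) * (a ! * b !) * R                     ≡⟨ lem ((a + b) C a) (a !) (b !) R ⟩
      ((a + b) C a) * (a ! * 1 * b ! * R)                 ∎
      where
      open ≡-Reasoning
      R = rising (a + b) e
      lem : ∀ C x y R → C * (x * y) * R ≡ C * (x * 1 * y * R)
      lem = solve-∀

  arrangements-one-cut : ∀ c → c cut ≡ 1 →
                         (sumRoles c) ! ≤ sumRoles c * (((c inA + c inB) C c inA) * arrangements c)
  arrangements-one-cut c c-cut≡1 =
    subst (λ k → Count ⟨ c inA , k , c inB , c free ⟩) (sym c-cut≡1) (explicit (c inA) (c inB) (c free))
    where
    Count : Tally → Set
    Count d = (sumRoles d) ! ≤ sumRoles d * (((d inA + d inB) C d inA) * arrangements d)
    explicit : ∀ a b e → Count ⟨ a , 1 , b , e ⟩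
    explicit a b e rewrite +-suc a (b + e) | +-assoc a 1 b | +-suc a b | sym (+-assoc a b e) = begin
      (suc (a + b) + e) !
        ≡⟨ !*rising (suc (a + b)) e ⟨
      suc (a + b) * (a + b) ! * R
        ≡⟨ cong (λ x → suc (a + b) * x * R) (binomial*factorials a b) ⟨
      suc (a + b) * (B * (a ! * b !)) * R
        ≤⟨ *-monoˡ-≤ R (*-monoˡ-≤ (B * (a ! * b !)) (m≤m+n (suc (a + b)) e)) ⟩
      (suc (a + b) + e) * (B * (a ! * b !)) * R
        ≡⟨ lem (suc (a + b) + e) B (a !) (b !) R ⟩
      (suc (a + b) + e) * (B * (a ! * 1 * b ! * R)) ∎
      where
      open ≤-Reasoning
      B = (a + b) C a
      R = rising (suc (a + b)) e
      lem : ∀ T C x y R → T * (C * (x * y)) * R ≡ T * (C * (x * 1 * y * R))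
      lem = solve-∀

module Configurations (m r : ℕ) where

  open SumsAndProducts
  open OrderCounting
  open import Data.Bool.Base using (Bool; true; false; if_then_else_; _∧_; T)
  open import Data.Bool.Properties using (if-float; if-∧; if-swap-then; T-∧)
  open import Data.Fin.Base using (Fin; zero; suc; punchOut; splitAt)
  open import Data.Fin.Properties using (_≟_; ¬Fin0; punchIn-punchOut)
  open import Data.Nat.Base using (ℕ; zero; suc; _+_; _*_; _≤_; _<_; z≤n; s≤s; pred; _!)
  open import Data.Nat.Properties
    using (+-assoc; *-assoc; *-identityʳ; *-identityˡ; <⇒≢; 1≤n!; +-*-semiring; module ≤-Reasoning)
  open import Data.Product.Base using (∃₂; _×_; _,_; proj₁; proj₂)
  open import Data.Sum.Base using (inj₁; inj₂)
  open import Data.Vec.Functional using (Vector; removeAt; _++_)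
  open import Function.Base using (_∘_)
  open import Function.Bundles using (Equivalence)
  open import Relation.Binary.PropositionalEquality
  open import Relation.Nullary.Decidable using (⌊_⌋; yes; no; decidable-stable)
  open import Relation.Nullary.Negation using (¬_)
  open import Algebra.Properties.Semiring.Sum +-*-semiring
    renaming (sum to ∑)
    using (sum-syntax; sum-remove; sum-cong-≗; ∑-comm; ∑-distrib-+; *-distribʳ-sum)

  private
    variable
      N : ℕ

  record Point : Set where
    constructor point
    field
      label : Fin r
      role  : Fin m → Role
  open Point public

  Configuration : ℕ → Set
  Configuration = Vector Point

  count : (Point → Bool) → Configuration N → ℕ
  count {N} P L = ∑[ x < N ] (if P (L x) then 1 else 0)

  inBlock : Fin r → Point → Bool
  inBlock κ p = ⌊ label p ≟ κ ⌋

  inTally : Fin m → Fin r → Role → Point → Bool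
  inTally i κ s p = inBlock κ p ∧ role p i == s

  size : Configuration N → Fin r → ℕ
  size L κ = count (inBlock κ) L

  tallyOf : Configuration N → Fin m → Fin r → Tally
  tallyOf L i κ s = count (inTally i κ s) L

  orderings : Configuration N → ℕ
  orderings L = prodℕ (λ κ → size L κ !)

  goodOrderings : Configuration N → Fin m → ℕ
  goodOrderings L i = prodℕ (λ κ → arrangements (tallyOf L i κ))

  goodSum : Configuration N → (Fin m → Bool) → ℕ
  goodSum L act = ∑[ i < m ] (if act i then goodOrderings L i else 0)

  mayBeLast : Configuration N → Fin N → Fin m → Bool
  mayBeLast L x i = lastable (role (L x) i) (tallyOf L i (label (L x)))

  survivors : Configuration N → (Fin m → Bool) → Fin N → Fin m → Bool
  survivors L act x i = act i ∧ mayBeLast L x i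

  -- If i and j cross at p and q, no ordering is good for both: p must precede q for i and
  -- follow it for j.
  Crosses : Fin m → Fin m → Point → Point → Set
  Crosses i j p q = label p ≡ label q × role p i ≺ role q i × role q j ≺ role p j

  Crossing : Configuration N → Fin m → Fin m → Set
  Crossing L i j = ∃₂ λ x y → Crosses i j (L x) (L y)

  Separated : Configuration N → (Fin m → Bool) → Set
  Separated L act = ∀ {i j} → T (act i) → T (act j) → i ≢ j → Crossing L i j

  count-remove : ∀ P (L : Configuration (suc N)) x →
                 count P L ≡ (if P (L x) then 1 else 0) + count P (removeAt L x)
  count-remove P L x = sum-remove {i = x} (λ y → if P (L y) then 1 else 0)

  count-removeAt : ∀ P (L : Configuration (suc N)) x →
                   count P (removeAt L x) ≡ (if P (L x) then pred (count P L) else count P L)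
  count-removeAt P L x with P (L x) | count-remove P L x
  ... | true  | eq = sym (cong pred eq)
  ... | false | eq = sym eq

  count-pos : ∀ P (L : Configuration (suc N)) x → P (L x) ≡ true → 0 < count P L
  count-pos P L x Px rewrite count-remove P L x | Px = s≤s z≤n

  count-++ : ∀ {a b} P (u : Configuration a) (v : Configuration b) → count P (u ++ v) ≡ count P u + count P v
  count-++ {zero}  P u v = refl
  count-++ {suc a} P u v =
    trans (cong (indicator (u zero) +_) (trans (sum-cong-≗ shift) (count-++ P (u ∘ suc) v)))
          (sym (+-assoc (indicator (u zero)) (count P (u ∘ suc)) (count P v)))
    where
    indicator : Point → ℕ
    indicator p = if P p then 1 else 0
    shift : ∀ x → indicator ((u ++ v) (suc x)) ≡ indicator ((u ∘ suc ++ v) x)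
    shift x with splitAt a x
    ... | inj₁ _ = refl
    ... | inj₂ _ = refl

  inBlock-label : ∀ p → inBlock (label p) p ≡ true
  inBlock-label p = cong ⌊_⌋ (≡-≟-identity _≟_ refl)

  inBlock-other : ∀ p κ → label p ≢ κ → inBlock κ p ≡ false
  inBlock-other p κ p∉κ = cong ⌊_⌋ (≢-≟-identity _≟_ p∉κ)

  tallyOf-removeAt : ∀ (L : Configuration (suc N)) x i s →
    tallyOf (removeAt L x) i (label (L x)) s ≡ (tallyOf L i (label (L x)) ─ role (L x) i) s
  tallyOf-removeAt L x i s = trans (count-removeAt (inTally i (label (L x)) s) L x)
    (cong (λ b → if b ∧ role (L x) i == s then pred c else c) (inBlock-label (L x)))
    where c = tallyOf L i (label (L x)) s

  tallyOf-removeAt-other : ∀ (L : Configuration (suc N)) x i κ → label (L x) ≢ κ → ∀ s →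
                           tallyOf (removeAt L x) i κ s ≡ tallyOf L i κ s
  tallyOf-removeAt-other L x i κ x∉κ s = trans (count-removeAt (inTally i κ s) L x)
    (cong (λ b → if b ∧ role (L x) i == s then pred c else c) (inBlock-other (L x) κ x∉κ))
    where c = tallyOf L i κ s

  tallyOf-pos : ∀ (L : Configuration (suc N)) i y κ → label (L y) ≡ κ → 0 < tallyOf L i κ (role (L y) i)
  tallyOf-pos L i y κ refl =
    count-pos (inTally i (label (L y)) (role (L y) i)) L y
              (cong₂ _∧_ (inBlock-label (L y)) (==-refl (role (L y) i)))

  size-removeAt : ∀ (L : Configuration (suc N)) x →
                  size (removeAt L x) (label (L x)) ≡ pred (size L (label (L x)))
  size-removeAt L x = trans (count-removeAt (inBlock (label (L x))) L x)
    (cong (λ b → if b then pred c else c) (inBlock-label (L x)))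
    where c = size L (label (L x))

  size-removeAt-other : ∀ (L : Configuration (suc N)) x κ → label (L x) ≢ κ →
                        size (removeAt L x) κ ≡ size L κ
  size-removeAt-other L x κ x∉κ = trans (count-removeAt (inBlock κ) L x)
    (cong (λ b → if b then pred c else c) (inBlock-other (L x) κ x∉κ))
    where c = size L κ

  ∑-sumRoles-comm : ∀ {n} (f : Fin n → Tally) →
                    ∑[ x < n ] sumRoles (f x) ≡ sumRoles (λ s → ∑[ x < n ] f x s)
  ∑-sumRoles-comm {n} f = begin
    ∑[ x < n ] (f x inA + (f x cut + (f x inB + f x free)))
      ≡⟨ ∑-distrib-+ (column inA) (λ x → f x cut + (f x inB + f x free)) ⟩
    ∑ (column inA) + ∑[ x < n ] (f x cut + (f x inB + f x free))
      ≡⟨ cong (∑ (column inA) +_) (∑-distrib-+ (column cut) (λ x → f x inB + f x free)) ⟩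
    ∑ (column inA) + (∑ (column cut) + ∑[ x < n ] (f x inB + f x free))
      ≡⟨ cong (λ t → ∑ (column inA) + (∑ (column cut) + t)) (∑-distrib-+ (column inB) (column free)) ⟩
    sumRoles (λ s → ∑ (column s)) ∎
    where
    open ≡-Reasoning
    column : Role → Vector ℕ n
    column s x = f x s

  sum-by-role : ∀ (L : Configuration N) i κ (g : Role → ℕ) →
    ∑[ x < N ] (if inBlock κ (L x) then g (role (L x) i) else 0) ≡ sumRoles (λ s → tallyOf L i κ s * g s)
  sum-by-role {N} L i κ g = begin
    ∑[ x < N ] (if inBlock κ (L x) then g (role (L x) i) else 0)
      ≡⟨ sum-cong-≗ expand ⟨
    ∑[ x < N ] sumRoles (λ s → (if inTally i κ s (L x) then 1 else 0) * g s)
      ≡⟨ ∑-sumRoles-comm (λ x s → (if inTally i κ s (L x) then 1 else 0) * g s) ⟩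
    sumRoles (λ s → ∑[ x < N ] ((if inTally i κ s (L x) then 1 else 0) * g s))
      ≡⟨ sumRoles-cong (λ s → *-distribʳ-sum (g s) (λ x → if inTally i κ s (L x) then 1 else 0)) ⟨
    sumRoles (λ s → tallyOf L i κ s * g s) ∎
    where
    open ≡-Reasoning
    expand : ∀ x → sumRoles (λ s → (if inTally i κ s (L x) then 1 else 0) * g s) ≡
                   (if inBlock κ (L x) then g (role (L x) i) else 0)
    expand x with inBlock κ (L x)
    ... | false = refl
    ... | true  = trans (sumRoles-cong (λ s → indicator-* (role (L x) i == s) (g s)))
                        (sumRoles-select (role (L x) i) g)

  size≡sumRoles : ∀ (L : Configuration N) i κ → size L κ ≡ sumRoles (tallyOf L i κ)
  size≡sumRoles L i κ =
    trans (sum-by-role L i κ (λ _ → 1)) (sumRoles-cong (λ s → *-identityʳ (tallyOf L i κ s)))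

  goodOrderings-removeAt : ∀ (L : Configuration (suc N)) x i →
    goodOrderings (removeAt L x) i ≡
    arrangements (tallyOf L i (label (L x)) ─ role (L x) i) *
    prodℕ-except (λ κ → arrangements (tallyOf L i κ)) (label (L x))
  goodOrderings-removeAt L x i = trans
    (prodℕ-split-agreeing (label (L x))
      (λ κ κ≢x → arrangements-cong (tallyOf-removeAt-other L x i κ (κ≢x ∘ sym))))
    (cong (_* prodℕ-except (λ κ → arrangements (tallyOf L i κ)) (label (L x)))
          (arrangements-cong (tallyOf-removeAt L x i)))

  orderings-removeAt : ∀ (L : Configuration (suc N)) x →
    orderings (removeAt L x) ≡ pred (size L (label (L x))) ! * prodℕ-except (λ κ → size L κ !) (label (L x))
  orderings-removeAt L x = trans
    (prodℕ-split-agreeing (label (L x)) (λ κ κ≢x → cong _! (size-removeAt-other L x κ (κ≢x ∘ sym))))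
    (cong (λ n → n ! * prodℕ-except (λ κ → size L κ !) (label (L x))) (size-removeAt L x))

  goodOrderings-last : ∀ (L : Configuration (suc N)) i κ → 0 < size L κ →
    goodOrderings L i ≡
    ∑[ x < suc N ] (if inBlock κ (L x) then (if mayBeLast L x i then goodOrderings (removeAt L x) i else 0) else 0)
  goodOrderings-last {N} L i κ κ≠∅ = sym (begin
    ∑[ x < suc N ] (if inBlock κ (L x) then (if mayBeLast L x i then goodOrderings (removeAt L x) i else 0) else 0)
      ≡⟨ sum-cong-≗ term ⟩
    ∑[ x < suc N ] ((if inBlock κ (L x) then g (role (L x) i) else 0) * others)
      ≡⟨ *-distribʳ-sum others (λ x → if inBlock κ (L x) then g (role (L x) i) else 0) ⟨
    ∑[ x < suc N ] (if inBlock κ (L x) then g (role (L x) i) else 0) * others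
      ≡⟨ cong (_* others) (sum-by-role L i κ g) ⟩
    sumRoles (λ s → c s * g s) * others
      ≡⟨ cong (_* others) (arrangements-last c (subst (0 <_) (size≡sumRoles L i κ) κ≠∅)) ⟨
    arrangements c * others
      ≡⟨ prodℕ-split (λ κ′ → arrangements (tallyOf L i κ′)) κ ⟨
    goodOrderings L i ∎)
    where
    open ≡-Reasoning
    c = tallyOf L i κ
    others = prodℕ-except (λ κ′ → arrangements (tallyOf L i κ′)) κ
    g : Role → ℕ
    g s = if lastable s c then arrangements (c ─ s) else 0
    term : ∀ x → (if inBlock κ (L x) then (if mayBeLast L x i then goodOrderings (removeAt L x) i else 0) else 0) ≡
                 (if inBlock κ (L x) then g (role (L x) i) else 0) * others
    term x with label (L x) ≟ κ
    ... | no _     = refl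
    ... | yes refl = trans (cong (λ w → if mayBeLast L x i then w else 0) (goodOrderings-removeAt L x i))
                           (sym (if-float (_* others) (mayBeLast L x i)))

  orderings-last : ∀ (L : Configuration (suc N)) κ → 0 < size L κ →
    orderings L ≡ ∑[ x < suc N ] (if inBlock κ (L x) then orderings (removeAt L x) else 0)
  orderings-last {N} L κ κ≠∅ = sym (begin
    ∑[ x < suc N ] (if inBlock κ (L x) then orderings (removeAt L x) else 0)
      ≡⟨ sum-cong-≗ term ⟩
    ∑[ x < suc N ] ((if inBlock κ (L x) then 1 else 0) * rest)
      ≡⟨ *-distribʳ-sum rest (λ x → if inBlock κ (L x) then 1 else 0) ⟨
    size L κ * rest
      ≡⟨ unfold-! (size L κ) κ≠∅ ⟩
    size L κ ! * others
      ≡⟨ prodℕ-split (λ κ′ → size L κ′ !) κ ⟨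
    orderings L ∎)
    where
    open ≡-Reasoning
    others = prodℕ-except (λ κ′ → size L κ′ !) κ
    rest = pred (size L κ) ! * others
    unfold-! : ∀ n → 0 < n → n * (pred n ! * others) ≡ n ! * others
    unfold-! (suc n) _ = sym (*-assoc (suc n) (n !) others)
    term : ∀ x → (if inBlock κ (L x) then orderings (removeAt L x) else 0) ≡
                 (if inBlock κ (L x) then 1 else 0) * rest
    term x with label (L x) ≟ κ
    ... | no _     = refl
    ... | yes refl = trans (orderings-removeAt L x) (sym (*-identityˡ rest))

  goodSum-last : ∀ (L : Configuration (suc N)) act κ → 0 < size L κ →
    goodSum L act ≡ ∑[ x < suc N ] (if inBlock κ (L x) then goodSum (removeAt L x) (survivors L act x) else 0)
  goodSum-last {N} L act κ κ≠∅ = begin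
    ∑[ i < m ] (if act i then goodOrderings L i else 0)
      ≡⟨ sum-cong-≗ (λ i → cong (λ w → if act i then w else 0) (goodOrderings-last L i κ κ≠∅)) ⟩
    ∑[ i < m ] (if act i then ∑[ x < suc N ] term i x else 0)
      ≡⟨ sum-cong-≗ (λ i → ∑-if (act i) (term i)) ⟨
    ∑[ i < m ] ∑[ x < suc N ] (if act i then term i x else 0)
      ≡⟨ sum-cong-≗ (λ i → sum-cong-≗ (restrict i)) ⟩
    ∑[ i < m ] ∑[ x < suc N ] (if inBlock κ (L x) then survivorTerm x i else 0)
      ≡⟨ ∑-comm (λ i x → if inBlock κ (L x) then survivorTerm x i else 0) ⟩
    ∑[ x < suc N ] ∑[ i < m ] (if inBlock κ (L x) then survivorTerm x i else 0)
      ≡⟨ sum-cong-≗ (λ x → ∑-if (inBlock κ (L x)) (survivorTerm x)) ⟩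
    ∑[ x < suc N ] (if inBlock κ (L x) then goodSum (removeAt L x) (survivors L act x) else 0) ∎
    where
    open ≡-Reasoning
    term : Fin m → Fin (suc N) → ℕ
    term i x = if inBlock κ (L x) then (if mayBeLast L x i then goodOrderings (removeAt L x) i else 0) else 0
    survivorTerm : Fin (suc N) → Fin m → ℕ
    survivorTerm x i = if survivors L act x i then goodOrderings (removeAt L x) i else 0
    restrict : ∀ i x → (if act i then term i x else 0) ≡ (if inBlock κ (L x) then survivorTerm x i else 0)
    restrict i x = trans (if-swap-then (act i) (inBlock κ (L x)))
                         (cong (λ w → if inBlock κ (L x) then w else 0) (sym (if-∧ (act i))))

  mayBeLast⇒¬≺ : ∀ (L : Configuration (suc N)) z y i → T (mayBeLast L z i) → label (L z) ≡ label (L y) →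
                 ¬ (role (L z) i ≺ role (L y) i)
  mayBeLast⇒¬≺ L z y i last same z≺y =
    <⇒≢ (tallyOf-pos L i y (label (L z)) (sym same)) (sym (lastable-≺ (tallyOf L i (label (L z))) last z≺y))

  separated-removeAt : ∀ (L : Configuration (suc N)) act z → Separated L act →
                       Separated (removeAt L z) (survivors L act z)
  separated-removeAt L act z separated {i} {j} sᵢ sⱼ i≢j =
    shift (separated (proj₁ sᵢ′) (proj₁ sⱼ′) i≢j)
    where
    sᵢ′ = Equivalence.to T-∧ sᵢ
    sⱼ′ = Equivalence.to T-∧ sⱼ
    shift : Crossing L i j → Crossing (removeAt L z) i j
    shift (x , y , crosses@(same , x≺y , y≺x)) =
      punchOut z≢x , punchOut z≢y ,
      subst₂ (Crosses i j) (cong L (sym (punchIn-punchOut z≢x))) (cong L (sym (punchIn-punchOut z≢y))) crosses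
      where
      z≢x : z ≢ x
      z≢x refl = mayBeLast⇒¬≺ L z y i (proj₂ sᵢ′) same x≺y
      z≢y : z ≢ y
      z≢y refl = mayBeLast⇒¬≺ L z x j (proj₂ sⱼ′) (sym same) y≺x

  goodSum-empty : ∀ (L : Configuration 0) act → Separated L act → goodSum L act ≤ 1
  goodSum-empty L act separated = begin
    goodSum L act
      ≡⟨ sum-cong-≗ (λ i → cong (λ w → if act i then w else 0) (prodℕ-ones r)) ⟩
    ∑[ i < m ] (if act i then 1 else 0)
      ≤⟨ indicator-sum-≤1 act unique ⟩
    1 ∎
    where
    open ≤-Reasoning
    unique : ∀ {i j} → T (act i) → T (act j) → i ≡ j
    unique {i} {j} aᵢ aⱼ = decidable-stable (i ≟ j) (λ i≢j → ¬Fin0 (proj₁ (separated aᵢ aⱼ i≢j)))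

  goodSum≤orderings : ∀ (L : Configuration N) act → Separated L act → goodSum L act ≤ orderings L
  goodSum≤orderings {zero}  L act separated =
    subst (goodSum L act ≤_) (sym (prodℕ-ones r)) (goodSum-empty L act separated)
  goodSum≤orderings {suc N} L act separated = begin
    goodSum L act
      ≡⟨ goodSum-last L act κ κ≠∅ ⟩
    ∑[ x < suc N ] (if inBlock κ (L x) then goodSum (removeAt L x) (survivors L act x) else 0)
      ≤⟨ ∑-mono-≤ (λ x → if-mono-≤ (inBlock κ (L x))
           (goodSum≤orderings (removeAt L x) (survivors L act x) (separated-removeAt L act x separated))) ⟩
    ∑[ x < suc N ] (if inBlock κ (L x) then orderings (removeAt L x) else 0)
      ≡⟨ orderings-last L κ κ≠∅ ⟨
    orderings L ∎
    where
    open ≤-Reasoning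
    κ = label (L zero)
    κ≠∅ = count-pos (inBlock κ) L zero (inBlock-label (L zero))

  orderings-pos : ∀ (L : Configuration N) → 0 < orderings L
  orderings-pos L = subst (_≤ orderings L) (prodℕ-ones r) (prodℕ-mono-≤ (λ κ → 1≤n! (size L κ)))

module ReciprocalSums where

  import Data.Fin.Base as F
  open import Data.Integer.Base as ℤ using (+_; +≤+)
  import Data.Integer.Properties as ℤ
  open import Data.Integer.Tactic.RingSolver using (solve-∀)
  open import Data.Nat.Base as ℕ using (zero; suc)
  import Data.Nat.Properties as ℕ
  open import Data.Rational.Base using (ℚ; _/_; _≤_; _+_; toℚᵘ)
  open import Data.Rational.Properties
    using (toℚᵘ-fromℚᵘ; toℚᵘ-cancel-≤; toℚᵘ-injective; toℚᵘ-homo-+;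
           ≤-trans; ≤-reflexive; +-mono-≤; 0/n≡0)
  open import Data.Rational.Unnormalised.Base as ℚᵘ using (mkℚᵘ; *≤*; *≡*)
  import Data.Rational.Unnormalised.Properties as ℚᵘ
  open import Function.Base using (_∘_)
  open import Relation.Binary.PropositionalEquality
  open import Algebra.Properties.Semiring.Sum ℕ.+-*-semiring renaming (sum to ∑) using ()

  toℚᵘ-/ : ∀ a d → toℚᵘ (+ a / suc d) ℚᵘ.≃ mkℚᵘ (+ a) d
  toℚᵘ-/ a d = toℚᵘ-fromℚᵘ (mkℚᵘ (+ a) d)

  /-mono-≤ : ∀ a b d e → a ℕ.* suc e ℕ.≤ b ℕ.* suc d → + a / suc d ≤ + b / suc e
  /-mono-≤ a b d e ae≤bd = toℚᵘ-cancel-≤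
    (ℚᵘ.≤-respˡ-≃ (ℚᵘ.≃-sym (toℚᵘ-/ a d)) (ℚᵘ.≤-respʳ-≃ (ℚᵘ.≃-sym (toℚᵘ-/ b e))
      (*≤* (subst₂ ℤ._≤_ (ℤ.pos-* a (suc e)) (ℤ.pos-* b (suc d)) (+≤+ ae≤bd)))))

  /-+ : ∀ a b d → + a / suc d + + b / suc d ≡ + (a ℕ.+ b) / suc d
  /-+ a b d = toℚᵘ-injective (ℚᵘ.≃-trans (toℚᵘ-homo-+ (+ a / suc d) (+ b / suc d))
    (ℚᵘ.≃-trans (ℚᵘ.+-cong (toℚᵘ-/ a d) (toℚᵘ-/ b d))
    (ℚᵘ.≃-trans sum (ℚᵘ.≃-sym (toℚᵘ-/ (a ℕ.+ b) d)))))
    where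
    lem : ∀ x y z → (x ℤ.* z ℤ.+ y ℤ.* z) ℤ.* z ≡ (x ℤ.+ y) ℤ.* (z ℤ.* z)
    lem = solve-∀
    sum : mkℚᵘ (+ a) d ℚᵘ.+ mkℚᵘ (+ b) d ℚᵘ.≃ mkℚᵘ (+ (a ℕ.+ b)) d
    sum = *≡* (trans (lem (+ a) (+ b) (+ suc d))
                     (sym (cong₂ ℤ._*_ (ℤ.pos-+ a b) (ℤ.pos-* (suc d) (suc d)))))

  sumℚ-≤ : ∀ {m} (f : Fin m → ℚ) (w : Fin m → ℕ) d → (∀ i → f i ≤ + w i / suc d) →
           sumℚ f ≤ + ∑ w / suc d
  sumℚ-≤ {zero}  f w d f≤w = ≤-reflexive (sym (0/n≡0 (suc d)))
  sumℚ-≤ {suc m} f w d f≤w =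
    ≤-trans (+-mono-≤ (f≤w F.zero) (sumℚ-≤ (f ∘ F.suc) (w ∘ F.suc) d (f≤w ∘ F.suc)))
            (≤-reflexive (/-+ (w F.zero) (∑ (w ∘ F.suc)) d))

  recip-≤ : ∀ p w d → suc d ℕ.≤ p ℕ.* w → recip p ≤ + w / suc d
  recip-≤ (suc p) w d d<pw = /-mono-≤ 1 w p d
    (subst₂ ℕ._≤_ (sym (ℕ.*-identityˡ (suc d))) (ℕ.*-comm (suc p) w) d<pw)

  sumℚ-recip-≤ : ∀ {m} (p w : Fin m → ℕ) q D e → 0 ℕ.< D → (∀ i → D ℕ.≤ p i ℕ.* w i) →
                 ∑ w ℕ.* suc e ℕ.≤ q ℕ.* D → sumℚ (λ i → recip (p i)) ≤ + q / suc e
  sumℚ-recip-≤ p w q (suc d) e _ D≤pw ∑w≤q =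
    ≤-trans (sumℚ-≤ (recip ∘ p) w d (λ i → recip-≤ (p i) (w i) d (D≤pw i)))
            (/-mono-≤ (∑ w) q d e ∑w≤q)

module EnlargedSystem {n r m : ℕ} (part : Fin n → Fin r) (A B : Fin m → Subset n) (l : Fin r) where

  open SumsAndProducts
  open OrderCounting
  open Configurations m r
  open import Data.Bool.Base using (Bool; true; false; if_then_else_; _∧_)
  open import Data.Bool.Properties using (∧-comm; ∧-zeroʳ; if-∧)
  open import Data.Fin.Base using (_↑ˡ_; _↑ʳ_)
  open import Data.Fin.Properties using (_≟_)
  open import Data.Fin.Subset using (_∩_; ∣_∣)
  open import Data.Fin.Subset.Properties using (nonempty?; x∈p∩q⁺; x∈p∩q⁻)
  open import Data.Nat.Base using (suc; _+_; _*_; _≤_; _!)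
  open import Data.Nat.Combinatorics using (_C_)
  open import Data.Nat.Properties
    using (+-comm; +-identityʳ; *-comm; *-assoc; *-identityʳ; *-identityˡ; *-monoˡ-≤; +-*-semiring;
           module ≤-Reasoning)
  open import Data.Product.Base using (∃; _×_; _,_; map)
  open import Data.Vec.Base using (_∷_; []; lookup)
  open import Data.Vec.Properties using (lookup-zipWith; lookup∘tabulate; []=⇒lookup; lookup⇒[]=)
  open import Data.Vec.Functional using (_++_)
  open import Data.Vec.Functional.Properties using (lookup-++ˡ; lookup-++ʳ)
  open import Function.Base using (_∘_)
  open import Function.Bundles using (Equivalence)
  open import Relation.Binary.PropositionalEquality
  open import Relation.Nullary.Decidable using (⌊_⌋; yes; no; decidable-stable)
  open import Relation.Nullary.Negation using (contradiction)
  open import Algebra.Properties.Semiring.Sum +-*-semiring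
    renaming (sum to ∑) using (sum-syntax; sum-cong-≗; sum-replicate-zero; *-distribʳ-sum)

  card≡∑ : ∀ {k} (p : Subset k) → ∣ p ∣ ≡ ∑[ x < k ] (if lookup p x then 1 else 0)
  card≡∑ []          = refl
  card≡∑ (true ∷ p)  = cong suc (card≡∑ p)
  card≡∑ (false ∷ p) = card≡∑ p

  card-∩-block : ∀ p κ →
                 ∣ p ∩ block part κ ∣ ≡ ∑[ x < n ] (if ⌊ part x ≟ κ ⌋ ∧ lookup p x then 1 else 0)
  card-∩-block p κ =
    trans (card≡∑ (p ∩ block part κ)) (sum-cong-≗ λ x → cong (λ b → if b then 1 else 0)
    (trans (lookup-zipWith _∧_ x p (block part κ))
           (trans (cong (lookup p x ∧_) (lookup∘tabulate (λ y → ⌊ part y ≟ κ ⌋) x))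
                  (∧-comm (lookup p x) ⌊ part x ≟ κ ⌋))))

  memberRole : Bool → Bool → Role
  memberRole true  _     = inA
  memberRole false true  = inB
  memberRole false false = free

  memberRole-inA : ∀ a b → memberRole a b == inA ≡ a
  memberRole-inA true  _     = refl
  memberRole-inA false true  = refl
  memberRole-inA false false = refl

  memberRole-inB : ∀ a b → (a ≡ true → b ≡ false) → memberRole a b == inB ≡ b
  memberRole-inB true  b     disjoint = sym (disjoint refl)
  memberRole-inB false true  _        = refl
  memberRole-inB false false _        = refl

  memberRole-cut : ∀ a b → memberRole a b == cut ≡ false
  memberRole-cut true  _     = refl
  memberRole-cut false true  = refl
  memberRole-cut false false = refl

  extraRole : Fin r → Role
  extraRole κ = if ⌊ κ ≟ l ⌋ then free else cut

  extraRole-inA : ∀ κ → extraRole κ == inA ≡ false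
  extraRole-inA κ with ⌊ κ ≟ l ⌋
  ... | true  = refl
  ... | false = refl

  extraRole-inB : ∀ κ → extraRole κ == inB ≡ false
  extraRole-inB κ with ⌊ κ ≟ l ⌋
  ... | true  = refl
  ... | false = refl

  member : Fin n → Point
  member x = point (part x) (λ i → memberRole (lookup (A i) x) (lookup (B i) x))

  extra : Fin r → Point
  extra κ = point κ (λ _ → extraRole κ)

  enlarged : Configuration (n + r)
  enlarged = member ++ extra

  size-enlarged : ∀ κ → size enlarged κ ≡ suc ∣ block part κ ∣
  size-enlarged κ = begin
    size enlarged κ                                          ≡⟨ count-++ (inBlock κ) member extra ⟩
    count (inBlock κ) member + count (inBlock κ) extra ≡⟨ cong₂ _+_ members (∑-δ κ (λ _ → 1)) ⟩
    ∣ block part κ ∣ + 1                                   ≡⟨ +-comm ∣ block part κ ∣ 1 ⟩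
    suc ∣ block part κ ∣                                   ∎
    where
    open ≡-Reasoning
    members : count (inBlock κ) member ≡ ∣ block part κ ∣
    members = sym (trans (card≡∑ (block part κ))
      (sum-cong-≗ λ x → cong (λ b → if b then 1 else 0) (lookup∘tabulate (λ y → ⌊ part y ≟ κ ⌋) x)))

  tallyOf-enlarged : ∀ i κ s →
                     tallyOf enlarged i κ s ≡ count (inTally i κ s) member + (if extraRole κ == s then 1 else 0)
  tallyOf-enlarged i κ s = trans (count-++ (inTally i κ s) member extra)
    (cong (count (inTally i κ s) member +_)
          (trans (sum-cong-≗ (λ κ′ → if-∧ ⌊ κ′ ≟ κ ⌋))
                 (∑-δ κ (λ κ′ → if extraRole κ′ == s then 1 else 0))))

  tallyOf-enlarged-member : ∀ i κ s (p : Subset n) →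
                            (∀ x → memberRole (lookup (A i) x) (lookup (B i) x) == s ≡ lookup p x) →
                            extraRole κ == s ≡ false → tallyOf enlarged i κ s ≡ ∣ p ∩ block part κ ∣
  tallyOf-enlarged-member i κ s p role≡p extraRole≢s = begin
    tallyOf enlarged i κ s
      ≡⟨ tallyOf-enlarged i κ s ⟩
    count (inTally i κ s) member + (if extraRole κ == s then 1 else 0)
      ≡⟨ cong (λ b → count (inTally i κ s) member + (if b then 1 else 0)) extraRole≢s ⟩
    count (inTally i κ s) member + 0
      ≡⟨ +-identityʳ (count (inTally i κ s) member) ⟩
    count (inTally i κ s) member
      ≡⟨ sum-cong-≗ (λ x → cong (λ b → if ⌊ part x ≟ κ ⌋ ∧ b then 1 else 0) (role≡p x)) ⟩
    ∑[ x < n ] (if ⌊ part x ≟ κ ⌋ ∧ lookup p x then 1 else 0)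
      ≡⟨ card-∩-block p κ ⟨
    ∣ p ∩ block part κ ∣ ∎
    where open ≡-Reasoning

  tallyOf-enlarged-inA : ∀ i κ → tallyOf enlarged i κ inA ≡ ∣ A i ∩ block part κ ∣
  tallyOf-enlarged-inA i κ =
    tallyOf-enlarged-member i κ inA (A i)
      (λ x → memberRole-inA (lookup (A i) x) (lookup (B i) x)) (extraRole-inA κ)

  tallyOf-enlarged-cut : ∀ i κ → tallyOf enlarged i κ cut ≡ (if extraRole κ == cut then 1 else 0)
  tallyOf-enlarged-cut i κ = trans (tallyOf-enlarged i κ cut)
    (cong (_+ (if extraRole κ == cut then 1 else 0)) (trans (sum-cong-≗ no-member) (sum-replicate-zero n)))
    where
    no-member : ∀ x → (if inTally i κ cut (member x) then 1 else 0) ≡ 0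
    no-member x = cong (λ b → if b then 1 else 0)
      (trans (cong (⌊ part x ≟ κ ⌋ ∧_) (memberRole-cut (lookup (A i) x) (lookup (B i) x)))
             (∧-zeroʳ ⌊ part x ≟ κ ⌋))

  tallyOf-enlarged-total : ∀ i κ → sumRoles (tallyOf enlarged i κ) ≡ suc ∣ block part κ ∣
  tallyOf-enlarged-total i κ = trans (sym (size≡sumRoles enlarged i κ)) (size-enlarged κ)

  binomials : Fin m → Fin r → ℕ
  binomials i κ = (∣ A i ∩ block part κ ∣ + ∣ B i ∩ block part κ ∣) C ∣ A i ∩ block part κ ∣

  slack : Fin r → ℕ
  slack κ = if ⌊ κ ≟ l ⌋ then 1 else suc ∣ block part κ ∣

  slack-product : prodℕ slack * suc ∣ block part l ∣ ≡ prodℕ (λ κ → suc ∣ block part κ ∣)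
  slack-product = begin
    prodℕ slack * suc ∣ block part l ∣
      ≡⟨ cong (_* suc ∣ block part l ∣) (prodℕ-split-agreeing l agree) ⟩
    slack l * others * suc ∣ block part l ∣
      ≡⟨ cong (λ t → t * others * suc ∣ block part l ∣) slack-l ⟩
    1 * others * suc ∣ block part l ∣
      ≡⟨ cong (_* suc ∣ block part l ∣) (*-identityˡ others) ⟩
    others * suc ∣ block part l ∣
      ≡⟨ *-comm others (suc ∣ block part l ∣) ⟩
    suc ∣ block part l ∣ * others
      ≡⟨ prodℕ-split (λ κ → suc ∣ block part κ ∣) l ⟨
    prodℕ (λ κ → suc ∣ block part κ ∣) ∎
    where
    open ≡-Reasoning
    others = prodℕ-except (λ κ → suc ∣ block part κ ∣) l
    slack-l : slack l ≡ 1
    slack-l = cong (λ b → if b then 1 else suc ∣ block part l ∣) (cong ⌊_⌋ (≡-≟-identity _≟_ refl))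
    agree : ∀ κ → κ ≢ l → slack κ ≡ suc ∣ block part κ ∣
    agree κ κ≢l = cong (λ b → if b then 1 else suc ∣ block part κ ∣)
                       (cong ⌊_⌋ (≢-≟-identity _≟_ κ≢l))

  module _ (bollobas : IsBollobas A B) where

    disjoint : ∀ i x → lookup (A i) x ≡ true → lookup (B i) x ≡ false
    disjoint i x x∈A with lookup (B i) x in x∈B
    ... | false = refl
    ... | true  = contradiction (x , x∈p∩q⁺ (lookup⇒[]= x (A i) x∈A , lookup⇒[]= x (B i) x∈B))
                                (Equivalence.from (bollobas i i) refl)

    disjoint′ : ∀ i x → lookup (B i) x ≡ true → lookup (A i) x ≡ false
    disjoint′ i x x∈B with lookup (A i) x in x∈A
    ... | false = refl
    ... | true  = contradiction (trans (sym (disjoint i x x∈A)) x∈B) λ ()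

    tallyOf-enlarged-inB : ∀ i κ → tallyOf enlarged i κ inB ≡ ∣ B i ∩ block part κ ∣
    tallyOf-enlarged-inB i κ = tallyOf-enlarged-member i κ inB (B i)
      (λ x → memberRole-inB (lookup (A i) x) (lookup (B i) x) (disjoint i x)) (extraRole-inB κ)

    factorial≤binomial*arrangements : ∀ i κ →
      suc ∣ block part κ ∣ ! ≤ binomials i κ * arrangements (tallyOf enlarged i κ) * slack κ
    factorial≤binomial*arrangements i κ with κ ≟ l | tallyOf-enlarged-cut i κ
    ... | yes refl | no-cut = begin
      suc ∣ block part l ∣ !                      ≡⟨ cong _! (tallyOf-enlarged-total i l) ⟨
      sumRoles c !                                ≡⟨ arrangements-cutless c no-cut ⟩
      ((c inA + c inB) C c inA) * arrangements c  ≡⟨ cong₂ (λ a b → ((a + b) C a) * arrangements c)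
                                                           (tallyOf-enlarged-inA i l) (tallyOf-enlarged-inB i l) ⟩
      binomials i l * arrangements c              ≡⟨ *-identityʳ (binomials i l * arrangements c) ⟨
      binomials i l * arrangements c * 1          ∎
      where
      open ≤-Reasoning
      c = tallyOf enlarged i l
    ... | no _ | one-cut = begin
      suc ∣ block part κ ∣ !                                     ≡⟨ cong _! (tallyOf-enlarged-total i κ) ⟨
      sumRoles c !                                               ≤⟨ arrangements-one-cut c one-cut ⟩
      sumRoles c * (((c inA + c inB) C c inA) * arrangements c)  ≡⟨ cong₂ (λ t b → t * (b * arrangements c))
                                                                          (tallyOf-enlarged-total i κ) binomial ⟩
      suc ∣ block part κ ∣ * (binomials i κ * arrangements c)    ≡⟨ *-comm (suc ∣ block part κ ∣) _ ⟩
      binomials i κ * arrangements c * suc ∣ block part κ ∣      ∎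
      where
      open ≤-Reasoning
      c = tallyOf enlarged i κ
      binomial : (c inA + c inB) C c inA ≡ binomials i κ
      binomial = cong₂ (λ a b → (a + b) C a) (tallyOf-enlarged-inA i κ) (tallyOf-enlarged-inB i κ)

    orderings≤binomials*goodOrderings : ∀ i →
      orderings enlarged ≤ prodℕ (binomials i) * (goodOrderings enlarged i * prodℕ slack)
    orderings≤binomials*goodOrderings i = begin
      prodℕ (λ κ → size enlarged κ !)
        ≡⟨ prodℕ-cong (λ κ → cong _! (size-enlarged κ)) ⟩
      prodℕ (λ κ → suc ∣ block part κ ∣ !)
        ≤⟨ prodℕ-mono-≤ (factorial≤binomial*arrangements i) ⟩
      prodℕ (λ κ → binomials i κ * arrangements (tallyOf enlarged i κ) * slack κ)
        ≡⟨ prodℕ-distrib-* (λ κ → binomials i κ * arrangements (tallyOf enlarged i κ)) slack ⟩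
      prodℕ (λ κ → binomials i κ * arrangements (tallyOf enlarged i κ)) * prodℕ slack
        ≡⟨ cong (_* prodℕ slack)
                (prodℕ-distrib-* (binomials i) (λ κ → arrangements (tallyOf enlarged i κ))) ⟩
      prodℕ (binomials i) * goodOrderings enlarged i * prodℕ slack
        ≡⟨ *-assoc (prodℕ (binomials i)) (goodOrderings enlarged i) (prodℕ slack) ⟩
      prodℕ (binomials i) * (goodOrderings enlarged i * prodℕ slack) ∎
      where open ≤-Reasoning

    witness : ∀ {i j} → i ≢ j → ∃ λ x → lookup (A i) x ≡ true × lookup (B j) x ≡ true
    witness {i} {j} i≢j
      with decidable-stable (nonempty? (A i ∩ B j)) (λ empty → i≢j (Equivalence.to (bollobas i j) empty))
    ... | x , x∈A∩B = x , map []=⇒lookup []=⇒lookup (x∈p∩q⁻ (A i) (B j) x∈A∩B)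

    member-extra : ∀ {i j x} → lookup (A i) x ≡ true → lookup (B j) x ≡ true → part x ≢ l →
                       Crosses i j (member x) (extra (part x))
    member-extra {i} {j} {x} x∈Aᵢ x∈Bⱼ x∉l
      rewrite x∈Aᵢ | disjoint′ j x x∈Bⱼ | x∈Bⱼ | ≢-≟-identity _≟_ x∉l
      = refl , inA≺cut , cut≺inB

    extra-member : ∀ {i j y} → lookup (A j) y ≡ true → lookup (B i) y ≡ true → part y ≢ l →
                       Crosses i j (extra (part y)) (member y)
    extra-member {i} {j} {y} y∈Aⱼ y∈Bᵢ y∉l
      rewrite y∈Aⱼ | disjoint′ i y y∈Bᵢ | y∈Bᵢ | ≢-≟-identity _≟_ y∉l
      = refl , cut≺inB , inA≺cut

    member-member : ∀ {i j x y} → lookup (A i) x ≡ true → lookup (B j) x ≡ true →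
                    lookup (A j) y ≡ true → lookup (B i) y ≡ true → part x ≡ part y →
                    Crosses i j (member x) (member y)
    member-member {i} {j} {x} {y} x∈Aᵢ x∈Bⱼ y∈Aⱼ y∈Bᵢ same
      rewrite x∈Aᵢ | disjoint′ j x x∈Bⱼ | x∈Bⱼ | y∈Aⱼ | disjoint′ i y y∈Bᵢ | y∈Bᵢ
      = same , inA≺inB , inA≺inB

    separated : Separated enlarged (λ _ → true)
    separated {i} {j} _ _ i≢j with witness i≢j | witness (i≢j ∘ sym)
    ... | x , x∈Aᵢ , x∈Bⱼ | y , y∈Aⱼ , y∈Bᵢ with part x ≟ l | part y ≟ l
    ... | no x∉l | _ = x ↑ˡ r , n ↑ʳ part x ,
      subst₂ (Crosses i j) (sym (lookup-++ˡ member extra x)) (sym (lookup-++ʳ member extra (part x)))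
             (member-extra x∈Aᵢ x∈Bⱼ x∉l)
    ... | yes _ | no y∉l = n ↑ʳ part y , y ↑ˡ r ,
      subst₂ (Crosses i j) (sym (lookup-++ʳ member extra (part y))) (sym (lookup-++ˡ member extra y))
             (extra-member y∈Aⱼ y∈Bᵢ y∉l)
    ... | yes x∈l | yes y∈l = x ↑ˡ r , y ↑ˡ r ,
      subst₂ (Crosses i j) (sym (lookup-++ˡ member extra x)) (sym (lookup-++ˡ member extra y))
             (member-member x∈Aᵢ x∈Bⱼ y∈Aⱼ y∈Bᵢ (trans x∈l (sym y∈l)))

    ∑goodOrderings-bound : ∑[ i < m ] (goodOrderings enlarged i * prodℕ slack) * suc ∣ block part l ∣ ≤
                           prodℕ (λ κ → suc ∣ block part κ ∣) * orderings enlarged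
    ∑goodOrderings-bound = begin
      ∑[ i < m ] (goodOrderings enlarged i * prodℕ slack) * suc ∣ block part l ∣
        ≡⟨ cong (_* suc ∣ block part l ∣) (*-distribʳ-sum (prodℕ slack) (goodOrderings enlarged)) ⟨
      goodSum enlarged (λ _ → true) * prodℕ slack * suc ∣ block part l ∣
        ≤⟨ *-monoˡ-≤ (suc ∣ block part l ∣)
             (*-monoˡ-≤ (prodℕ slack) (goodSum≤orderings enlarged (λ _ → true) separated)) ⟩
      orderings enlarged * prodℕ slack * suc ∣ block part l ∣
        ≡⟨ *-assoc (orderings enlarged) (prodℕ slack) (suc ∣ block part l ∣) ⟩
      orderings enlarged * (prodℕ slack * suc ∣ block part l ∣)
        ≡⟨ cong (orderings enlarged *_) slack-product ⟩
      orderings enlarged * prodℕ (λ κ → suc ∣ block part κ ∣)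
        ≡⟨ *-comm (orderings enlarged) (prodℕ (λ κ → suc ∣ block part κ ∣)) ⟩
      prodℕ (λ κ → suc ∣ block part κ ∣) * orderings enlarged ∎
      where open ≤-Reasoning

open import Data.Nat using (ℕ; suc; _+_)
open import Data.Nat.Combinatorics using (_C_)
open import Data.Fin using (Fin)
open import Data.Fin.Subset using (Subset; _∩_; ∣_∣)
open import Data.Integer using (+_)
open import Data.Rational using (_≤_; _/_)

lemma3p1 : (n r m : ℕ) (part : Fin n → Fin r)
    (A B : Fin m → Subset n) → IsBollobas A B → (l : Fin r) →
    sumℚ (λ i → recip (prodℕ (λ k →
      (∣ A i ∩ block part k ∣ + ∣ B i ∩ block part k ∣) C ∣ A i ∩ block part k ∣)))
    ≤ (+ prodℕ (λ k → suc ∣ block part k ∣)) / suc ∣ block part l ∣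
lemma3p1 n r m part A B bollobas l =
  sumℚ-recip-≤ (λ i → prodℕ (binomials i)) (λ i → goodOrderings enlarged i * prodℕ slack)
               (prodℕ (λ κ → suc ∣ block part κ ∣)) (orderings enlarged) ∣ block part l ∣
               (orderings-pos enlarged) (orderings≤binomials*goodOrderings bollobas) (∑goodOrderings-bound bollobas)
  where
  open Configurations m r using (goodOrderings; orderings; orderings-pos)
  open EnlargedSystem part A B l
  open ReciprocalSums using (sumℚ-recip-≤)
  open import Data.Nat using (_*_)
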